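{- Let $n,\ell,u$ be integers with $n\ge \ell+u$ (and $\ell,u\ge 0$). Fix $L\subseteq\{0,\dots,\ell-1\}$ and $U\subseteq\{n-u,\dots,n-1\}$. Let $R$ be a uniformly randomly chosen subset of $\{\ell,\dots,n-u-1\}$ and set $A:=L\cup R\cup U$. Then for any integer $k$ with $2\ell-1\le k\le n-u-1$, \[ \Pr(k\notin A+A)=\begin{cases}(1/2)^{|L|}(3/4)^{(k+1)/2-\ell}, & k \text{ odd},\\ (1/2)^{|L|+1}(3/4)^{k/2-\ell}, & k\text{ even}.\end{cases} \]
   Context: $A+A=\{a_1+a_2: a_1,a_2\in A\}$. "Uniformly randomly chosen subset" means each of the $2^{n-\ell-u}$ subsets is chosen with equal probability. -}

module Defs where

open import Data.Bool using (Bool; true; false)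
open import Data.Nat using (ℕ; zero; suc; _+_; _≤_; _<_; _≤?_; _<?_)
open import Data.Integer using (ℤ; +_)
import Data.Integer.Properties as ℤP
open import Data.Fin using (Fin; toℕ)
open import Data.Fin.Subset using (Subset; _∈_)
open import Data.Fin.Subset.Properties using (_∈?_)
open import Data.Fin.Properties using (any?; all?)
open import Data.Vec using (Vec; []; _∷_)
open import Data.List using (List; []; _∷_; map; _++_; filter; length)
open import Data.Product using (Σ; _×_; _,_; ∃)
open import Data.Sum using (_⊎_)
open import Relation.Binary.PropositionalEquality using (_≡_)
open import Relation.Nullary using (Dec; ¬_)
open import Relation.Nullary.Decidable using (_×-dec_; _⊎-dec_; _→-dec_; ¬?)

allSubsets : (n : ℕ) → List (Subset n)
allSubsets zero = [] ∷ []
allSubsets (suc n) = map (true ∷_) (allSubsets n) ++ map (false ∷_) (allSubsets n)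

-- R ⊆ {ℓ, …, n-u-1}  (element i of Fin n stands for the integer toℕ i)
InWindow : {n : ℕ} → ℕ → ℕ → Subset n → Set
InWindow {n} ℓ u R = ∀ i → i ∈ R → ℓ ≤ toℕ i × toℕ i + u < n

inWindow? : {n : ℕ} (ℓ u : ℕ) (R : Subset n) → Dec (InWindow ℓ u R)
inWindow? {n} ℓ u R = all? λ i → (i ∈? R) →-dec ((ℓ ≤? toℕ i) ×-dec (toℕ i + u <? n))

InA : {n : ℕ} → Subset n → Subset n → Subset n → Fin n → Set
InA L R U i = i ∈ L ⊎ i ∈ R ⊎ i ∈ U

inA? : {n : ℕ} (L R U : Subset n) (i : Fin n) → Dec (InA L R U i)
inA? L R U i = (i ∈? L) ⊎-dec ((i ∈? R) ⊎-dec (i ∈? U))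

InSumset : {n : ℕ} → Subset n → Subset n → Subset n → ℤ → Set
InSumset {n} L R U k =
  Σ (Fin n) λ a₁ → Σ (Fin n) λ a₂ →
    InA L R U a₁ × InA L R U a₂ × (+ (toℕ a₁ + toℕ a₂) ≡ k)

inSumset? : {n : ℕ} (L R U : Subset n) (k : ℤ) → Dec (InSumset L R U k)
inSumset? L R U k =
  any? λ a₁ → any? λ a₂ →
    inA? L R U a₁ ×-dec (inA? L R U a₂ ×-dec (+ (toℕ a₁ + toℕ a₂) ℤP.≟ k))

-- The sample space: all subsets R of {ℓ,…,n-u-1}  (uniform distribution on it)
windowSubsets : (n ℓ u : ℕ) → List (Subset n)
windowSubsets n ℓ u = filter (inWindow? ℓ u) (allSubsets n)

badCount : (n ℓ u : ℕ) → Subset n → Subset n → ℤ → ℕ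
badCount n ℓ u L U k =
  length (filter (λ R → ¬? (inSumset? L R U k)) (windowSubsets n ℓ u))

{-# OPTIONS --safe #-}
-- Write K = k + 1. Whether k ∈ A + A only involves A ∩ [0, K), which U does not reach; so,
-- splitting R = x ++ y ++ z with x the positions below K and z the last u positions, R is a
-- window with k ∉ A + A exactly when z is empty, y is arbitrary, and x has no element below ℓ
-- and no mirror pair {i, k - i} inside L ∪ x. These constraints act on disjoint mirror pairs,
-- so the admissible x are counted by peeling off the outermost pair: a pair inside [ℓ, K)
-- allows 3 of its 4 patterns, a pair {i, k - i} with i < ℓ allows 1 pattern if i ∈ L and 2
-- otherwise, and the middle point of an odd K must be absent. For K = 2(ℓ + e) + p this gives
-- 2^(ℓ - |L|) 3^e 2^|y| bad sets among 2^(ℓ + 2e + p + |y|) windows.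
module Submission where

open import Algebra.Bundles using (AbelianGroup)
open import Data.Bool using (Bool; true; false; T; not; _∧_; _∨_)
open import Data.Bool.Properties using (T-∧; T-∨; ∧-comm) renaming (_≟_ to _≟ᵇ_)
open import Data.Empty using (⊥-elim)
open import Data.Fin as Fin using (Fin; toℕ)
open import Data.Fin.Properties using (toℕ<n)
open import Data.Fin.Subset using (Subset; _∈_; ∣_∣; Empty) renaming (⊥ to ∅)
open import Data.Fin.Subset.Properties using (Empty-unique)
open import Data.Integer using (ℤ; +_) renaming (_+_ to _+ℤ_; _≤_ to _≤ℤ_)
import Data.Integer.Properties as ℤ
open import Data.List as List using (List; map; filter; length)
open import Data.List.Properties using (filter-++; length-++)
open import Data.Nat
  using (ℕ; zero; suc; _+_; _*_; _^_; _∸_; _≤_; _<_; _≤ᵇ_; _≤?_; _<?_; z≤n; s≤s)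
open import Data.Nat.Properties
open import Data.Nat.Tactic.RingSolver using (solve-∀)
open import Data.Product using (Σ; ∃-syntax; _×_; _,_; proj₁; proj₂)
open import Data.Product.Function.NonDependent.Propositional using (_×-⇔_)
open import Data.Sum using (_⊎_; inj₁; inj₂)
open import Data.Vec using (Vec; []; _∷_; _++_; _∷ʳ_; here; there)
open import Data.Vec.Properties using (≡-dec)
open import Function using (_∘_; _⇔_; mk⇔; Equivalence)
open import Function.Properties.Equivalence using () renaming (refl to ⇔-refl; trans to ⇔-trans)
open import Relation.Binary.PropositionalEquality
open import Relation.Nullary using (Dec; yes; no; does; ¬_; ¬?; _×-dec_)
open import Relation.Nullary.Decidable using (does-⇔; dec-true; dec-false; map′; T?)
open import Relation.Unary using (Decidable)
open import Algebra.Properties.CommutativeSemigroup +-commutativeSemigroup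
  using () renaming (interchange to +-interchange)
open import Algebra.Properties.CommutativeSemigroup *-commutativeSemigroup using (xy∙z≈xz∙y)
open import Algebra.Properties.Group (AbelianGroup.group ℤ.+-0-abelianGroup)
  using () renaming (∙-cancelʳ to ℤ-cancelʳ)
open import Defs

𝟙 : Bool → ℕ
𝟙 true  = 1
𝟙 false = 0

𝟙-∧ : ∀ b c → 𝟙 (b ∧ c) ≡ 𝟙 b * 𝟙 c
𝟙-∧ true  c = sym (+-identityʳ (𝟙 c))
𝟙-∧ false c = refl

T-not-∧ : ∀ p q → T (not (p ∧ q)) ⇔ (¬ (T p × T q))
T-not-∧ true  true  = mk⇔ (λ ()) (λ ¬p×q → ¬p×q _)
T-not-∧ true  false = mk⇔ (λ _ → proj₂) _
T-not-∧ false q     = mk⇔ (λ _ → proj₁) _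

≤ᵇ-true : ∀ {m n} → m ≤ n → (m ≤ᵇ n) ≡ true
≤ᵇ-true {m} {n} = dec-true (m ≤? n)

≤ᵇ-false : ∀ {m n} → n < m → (m ≤ᵇ n) ≡ false
≤ᵇ-false {m} {n} n<m = dec-false (m ≤? n) (<⇒≱ n<m)

∑ : (m : ℕ) → (Vec Bool m → ℕ) → ℕ
∑ zero    f = f []
∑ (suc m) f = ∑ m (f ∘ (true ∷_)) + ∑ m (f ∘ (false ∷_))

∑-cong : ∀ m {f g : Vec Bool m → ℕ} → (∀ v → f v ≡ g v) → ∑ m f ≡ ∑ m g
∑-cong zero    f≗g = f≗g []
∑-cong (suc m) f≗g =
  cong₂ _+_ (∑-cong m (f≗g ∘ (true ∷_))) (∑-cong m (f≗g ∘ (false ∷_)))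

∑-*ˡ : ∀ m c (f : Vec Bool m → ℕ) → ∑ m (λ v → c * f v) ≡ c * ∑ m f
∑-*ˡ zero    c f = refl
∑-*ˡ (suc m) c f =
  trans (cong₂ _+_ (∑-*ˡ m c (f ∘ (true ∷_))) (∑-*ˡ m c (f ∘ (false ∷_))))
        (sym (*-distribˡ-+ c (∑ m (f ∘ (true ∷_))) (∑ m (f ∘ (false ∷_)))))

∑-*ʳ : ∀ m c (f : Vec Bool m → ℕ) → ∑ m (λ v → f v * c) ≡ ∑ m f * c
∑-*ʳ zero    c f = refl
∑-*ʳ (suc m) c f =
  trans (cong₂ _+_ (∑-*ʳ m c (f ∘ (true ∷_))) (∑-*ʳ m c (f ∘ (false ∷_))))
        (sym (*-distribʳ-+ c (∑ m (f ∘ (true ∷_))) (∑ m (f ∘ (false ∷_)))))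

∑-const : ∀ m c → ∑ m (λ _ → c) ≡ c * 2 ^ m
∑-const zero    c = sym (*-identityʳ c)
∑-const (suc m) c = begin
  ∑ m (λ _ → c) + ∑ m (λ _ → c) ≡⟨ cong₂ _+_ (∑-const m c) (∑-const m c) ⟩
  c * 2 ^ m + c * 2 ^ m         ≡⟨ *-distribˡ-+ c (2 ^ m) (2 ^ m) ⟨
  c * (2 ^ m + 2 ^ m)           ≡⟨ cong (λ t → c * (2 ^ m + t)) (+-identityʳ (2 ^ m)) ⟨
  c * 2 ^ suc m                 ∎
  where open ≡-Reasoning

∑-++ : ∀ a b (f : Vec Bool (a + b) → ℕ) →
  ∑ (a + b) f ≡ ∑ a (λ x → ∑ b (λ y → f (x ++ y)))
∑-++ zero    b f = refl
∑-++ (suc a) b f = cong₂ _+_ (∑-++ a b _) (∑-++ a b _)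

∑-∷ʳ : ∀ m (f : Vec Bool (suc m) → ℕ) →
  ∑ (suc m) f ≡ ∑ m (λ w → f (w ∷ʳ true)) + ∑ m (λ w → f (w ∷ʳ false))
∑-∷ʳ zero    f = refl
∑-∷ʳ (suc m) f = trans
  (cong₂ _+_ (∑-∷ʳ m (f ∘ (true ∷_))) (∑-∷ʳ m (f ∘ (false ∷_))))
  (+-interchange (F true true) (F true false) (F false true) (F false false))
  where
  F : Bool → Bool → ℕ
  F b c = ∑ m (λ w → f (b ∷ (w ∷ʳ c)))

count : ∀ m {P : Vec Bool m → Set} → Decidable P → ℕ
count m P? = ∑ m (λ v → 𝟙 (does (P? v)))

_≟ᵛ_ : ∀ {m} (v w : Vec Bool m) → Dec (v ≡ w)
_≟ᵛ_ = ≡-dec _≟ᵇ_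

count-≡ : ∀ m (w : Vec Bool m) → count m (_≟ᵛ w) ≡ 1
count-≡ zero    []          = refl
count-≡ (suc m) (true ∷ w)  = cong₂ _+_ (count-≡ m w) (∑-const m 0)
count-≡ (suc m) (false ∷ w) = cong₂ _+_ (∑-const m 0) (count-≡ m w)

count-++³ : ∀ a s u {P : Vec Bool (a + (s + u)) → Set} {Q : Vec Bool a → Set} {S : Vec Bool u → Set}
  (P? : Decidable P) (Q? : Decidable Q) (S? : Decidable S) →
  (∀ x y z → P (x ++ y ++ z) ⇔ (Q x × S z)) →
  count (a + (s + u)) P? ≡ count a Q? * count u S? * 2 ^ s
count-++³ a s u P? Q? S? P⇔Q×S = begin
  count (a + (s + u)) P?
    ≡⟨ ∑-++ a (s + u) _ ⟩
  ∑ a (λ x → ∑ (s + u) (λ w → 𝟙 (does (P? (x ++ w)))))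
    ≡⟨ ∑-cong a (λ x → ∑-++ s u _) ⟩
  ∑ a (λ x → ∑ s (λ y → ∑ u (λ z → 𝟙 (does (P? (x ++ y ++ z))))))
    ≡⟨ ∑-cong a (λ x → ∑-cong s (λ y → ∑-cong u (λ z → separate x y z))) ⟩
  ∑ a (λ x → ∑ s (λ y → ∑ u (λ z → 𝟙 (does (Q? x)) * 𝟙 (does (S? z)))))
    ≡⟨ ∑-cong a (λ x → ∑-cong s (λ y → ∑-*ˡ u (𝟙 (does (Q? x))) _)) ⟩
  ∑ a (λ x → ∑ s (λ y → 𝟙 (does (Q? x)) * count u S?))
    ≡⟨ ∑-cong a (λ x → ∑-const s _) ⟩
  ∑ a (λ x → 𝟙 (does (Q? x)) * count u S? * 2 ^ s)
    ≡⟨ ∑-*ʳ a (2 ^ s) _ ⟩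
  ∑ a (λ x → 𝟙 (does (Q? x)) * count u S?) * 2 ^ s
    ≡⟨ cong (_* 2 ^ s) (∑-*ʳ a (count u S?) _) ⟩
  count a Q? * count u S? * 2 ^ s
    ∎
  where
  open ≡-Reasoning
  separate : ∀ x y z → 𝟙 (does (P? (x ++ y ++ z))) ≡ 𝟙 (does (Q? x)) * 𝟙 (does (S? z))
  separate x y z = trans (cong 𝟙 (does-⇔ (P⇔Q×S x y z) (P? _) (Q? x ×-dec S? z)))
                         (𝟙-∧ (does (Q? x)) (does (S? z)))

length-filter-map : ∀ {A B : Set} {P : B → Set} (P? : Decidable P) (f : A → B) xs →
  length (filter P? (map f xs)) ≡ length (filter (P? ∘ f) xs)
length-filter-map P? f List.[] = refl
length-filter-map P? f (x List.∷ xs) with does (P? (f x))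
... | true  = cong suc (length-filter-map P? f xs)
... | false = length-filter-map P? f xs

filter-filter : ∀ {A : Set} {P Q : A → Set} (P? : Decidable P) (Q? : Decidable Q) xs →
  filter Q? (filter P? xs) ≡ filter (λ x → P? x ×-dec Q? x) xs
filter-filter P? Q? List.[] = refl
filter-filter P? Q? (x List.∷ xs) with does (P? x)
... | false = filter-filter P? Q? xs
... | true with does (Q? x)
...   | true  = cong (x List.∷_) (filter-filter P? Q? xs)
...   | false = filter-filter P? Q? xs

length-filter-allSubsets : ∀ n {P : Subset n → Set} (P? : Decidable P) →
  length (filter P? (allSubsets n)) ≡ count n P?
length-filter-allSubsets zero    P? with does (P? [])
... | true  = refl
... | false = refl
length-filter-allSubsets (suc n) P? = begin
  length (filter P? (map (true ∷_) A List.++ map (false ∷_) A))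
    ≡⟨ cong length (filter-++ P? (map (true ∷_) A) _) ⟩
  length (filter P? (map (true ∷_) A) List.++ filter P? (map (false ∷_) A))
    ≡⟨ length-++ (filter P? (map (true ∷_) A)) ⟩
  length (filter P? (map (true ∷_) A)) + length (filter P? (map (false ∷_) A))
    ≡⟨ cong₂ _+_ (half true) (half false) ⟩
  count (suc n) P?
    ∎
  where
  open ≡-Reasoning
  A : List (Subset n)
  A = allSubsets n
  half : ∀ b → length (filter P? (map (b ∷_) A)) ≡ count n (P? ∘ (b ∷_))
  half b = trans (length-filter-map P? (b ∷_) A) (length-filter-allSubsets n (P? ∘ (b ∷_)))

at : ∀ {m} → Vec Bool m → ℕ → Bool
at []      _       = false
at (b ∷ v) zero    = b
at (b ∷ v) (suc a) = at v a

∈⇔at : ∀ {m} {v : Vec Bool m} {i : Fin m} → i ∈ v ⇔ T (at v (toℕ i))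
∈⇔at = mk⇔ to from
  where
  to : ∀ {m} {v : Vec Bool m} {i : Fin m} → i ∈ v → T (at v (toℕ i))
  to here        = _
  to (there i∈v) = to i∈v
  from : ∀ {m} {v : Vec Bool m} {i : Fin m} → T (at v (toℕ i)) → i ∈ v
  from {v = true ∷ v} {Fin.zero}  _ = here
  from {v = b ∷ v}    {Fin.suc i} t = there (from t)

at⇒∈ : ∀ {m} (v : Vec Bool m) {a} → T (at v a) → Σ (Fin m) λ i → toℕ i ≡ a × i ∈ v
at⇒∈ (true ∷ v) {zero}  _ = Fin.zero , refl , here
at⇒∈ (b ∷ v)    {suc a} t with at⇒∈ v t
... | i , refl , i∈v = Fin.suc i , refl , there i∈v

at-< : ∀ {m} (v : Vec Bool m) {a} → T (at v a) → a < m
at-< (b ∷ v) {zero}  _ = s≤s z≤n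
at-< (b ∷ v) {suc a} t = s≤s (at-< v t)

at-∅ : ∀ m a → ¬ T (at (∅ {m}) a)
at-∅ zero    a       ()
at-∅ (suc m) zero    ()
at-∅ (suc m) (suc a) = at-∅ m a

at-++ˡ : ∀ {m r} (x : Vec Bool m) (w : Vec Bool r) {a} → a < m → at (x ++ w) a ≡ at x a
at-++ˡ (b ∷ x) w {zero}  _         = refl
at-++ˡ (b ∷ x) w {suc a} (s≤s a<m) = at-++ˡ x w a<m

at-++ʳ : ∀ {m r} (x : Vec Bool m) (w : Vec Bool r) b → at (x ++ w) (m + b) ≡ at w b
at-++ʳ []      w b = refl
at-++ʳ (_ ∷ x) w b = at-++ʳ x w b

at-++ : ∀ {m r} (x : Vec Bool m) (w : Vec Bool r) a → T (at (x ++ w) a) →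
  (a < m × T (at x a)) ⊎ ∃[ b ] a ≡ m + b × T (at w b)
at-++ {m} x w a t with a <? m
... | yes a<m = inj₁ (a<m , subst T (at-++ˡ x w a<m) t)
... | no  a≮m with m≤n⇒∃[o]m+o≡n (≮⇒≥ a≮m)
...   | b , refl = inj₂ (b , refl , subst T (at-++ʳ x w b) t)

at-∷ʳ-< : ∀ {m} (w : Vec Bool m) c {a} → a < m → at (w ∷ʳ c) a ≡ at w a
at-∷ʳ-< (b ∷ w) c {zero}  _         = refl
at-∷ʳ-< (b ∷ w) c {suc a} (s≤s a<m) = at-∷ʳ-< w c a<m

at-∷ʳ : ∀ {m} (w : Vec Bool m) c → at (w ∷ʳ c) m ≡ c
at-∷ʳ []      c = refl
at-∷ʳ (_ ∷ w) c = at-∷ʳ w c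

trues : (ℕ → Bool) → ℕ → ℕ → ℕ
trues f j zero    = 0
trues f j (suc d) = 𝟙 (f j) + trues f (suc j) d

trues-+ : ∀ f j d d' → trues f j (d + d') ≡ trues f j d + trues f (j + d) d'
trues-+ f j zero    d' = cong (λ t → trues f t d') (sym (+-identityʳ j))
trues-+ f j (suc d) d' = begin
  𝟙 (f j) + trues f (suc j) (d + d')
    ≡⟨ cong (_+_ (𝟙 (f j))) (trues-+ f (suc j) d d') ⟩
  𝟙 (f j) + (trues f (suc j) d + trues f (suc j + d) d')
    ≡⟨ +-assoc (𝟙 (f j)) _ _ ⟨
  trues f j (suc d) + trues f (suc j + d) d'
    ≡⟨ cong (λ t → trues f j (suc d) + trues f t d') (+-suc j d) ⟨
  trues f j (suc d) + trues f (j + suc d) d'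
    ∎
  where open ≡-Reasoning

trues-none : ∀ f j d → (∀ a → T (f a) → a < j) → trues f j d ≡ 0
trues-none f j zero    _ = refl
trues-none f j (suc d) f<j with f j | f<j j
... | true  | j<j = ⊥-elim (<-irrefl refl (j<j _))
... | false | _   = trues-none f (suc j) d (λ a t → m<n⇒m<1+n (f<j a t))

trues-at-∷ : ∀ {m} b (v : Vec Bool m) j d → trues (at (b ∷ v)) (suc j) d ≡ trues (at v) j d
trues-at-∷ b v j zero    = refl
trues-at-∷ b v j (suc d) = cong (_+_ (𝟙 (at v j))) (trues-at-∷ b v (suc j) d)

∣∣≡trues : ∀ {m} (v : Vec Bool m) → ∣ v ∣ ≡ trues (at v) 0 m
∣∣≡trues []                = refl
∣∣≡trues {suc m} (true ∷ v)  = cong suc (trans (∣∣≡trues v) (sym (trues-at-∷ true v 0 m)))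
∣∣≡trues {suc m} (false ∷ v) = trans (∣∣≡trues v) (sym (trues-at-∷ false v 0 m))

∣∣≡trues-below : ∀ {m ℓ} (v : Vec Bool m) → ℓ ≤ m → (∀ a → T (at v a) → a < ℓ) →
  ∣ v ∣ ≡ trues (at v) 0 ℓ
∣∣≡trues-below {m} {ℓ} v ℓ≤m v<ℓ = begin
  ∣ v ∣                                     ≡⟨ ∣∣≡trues v ⟩
  trues (at v) 0 m                          ≡⟨ cong (trues (at v) 0) (m+[n∸m]≡n ℓ≤m) ⟨
  trues (at v) 0 (ℓ + (m ∸ ℓ))              ≡⟨ trues-+ (at v) 0 ℓ (m ∸ ℓ) ⟩
  trues (at v) 0 ℓ + trues (at v) ℓ (m ∸ ℓ) ≡⟨ cong (_+_ (trues (at v) 0 ℓ)) (trues-none (at v) ℓ (m ∸ ℓ) v<ℓ) ⟩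
  trues (at v) 0 ℓ + 0                      ≡⟨ +-identityʳ _ ⟩
  trues (at v) 0 ℓ                          ∎
  where open ≡-Reasoning

mirror-<ˡ : ∀ {i i' m} → suc (i + i') ≡ m → i < m
mirror-<ˡ {i} {i'} e = subst (i <_) e (s≤s (m≤m+n i i'))

mirror-<ʳ : ∀ {i i' m} → suc (i + i') ≡ m → i' < m
mirror-<ʳ {i} {i'} e = subst (i' <_) e (s≤s (m≤n+m i' i))

-- i + i' = m - 1, stated without truncated subtraction.
AllMirrorPairs : ℕ → (ℕ → ℕ → Set) → Set
AllMirrorPairs m P = ∀ i i' → suc (i + i') ≡ m → P i i'

allMirrorPairs? : ∀ {P : ℕ → ℕ → Set} → (∀ i i' → Dec (P i i')) → ∀ m →
  Dec (AllMirrorPairs m P)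
allMirrorPairs? {P} P? m = map′ to from (allUpTo? (λ i → P? i (m ∸ suc i)) m)
  where
  to : (∀ {i} → i < m → P i (m ∸ suc i)) → AllMirrorPairs m P
  to h i i' e = subst (P i) (trans (cong (_∸ suc i) (sym e)) (m+n∸m≡n (suc i) i')) (h (mirror-<ˡ e))
  from : AllMirrorPairs m P → ∀ {i} → i < m → P i (m ∸ suc i)
  from h {i} i<m = h i (m ∸ suc i) (m+[n∸m]≡n i<m)

module Mirror (ok : ℕ → ℕ → Bool → Bool → Bool)
              (ok-sym : ∀ a a' b c → ok a a' b c ≡ ok a' a c b) where

  -- x occupies the positions j, …, j + m - 1.
  Mirrored : ℕ → (m : ℕ) → Vec Bool m → Set
  Mirrored j m x = AllMirrorPairs m (λ i i' → T (ok (i + j) (i' + j) (at x i) (at x i')))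

  mirrored? : ∀ j m → Decidable (Mirrored j m)
  mirrored? j m x = allMirrorPairs? (λ i i' → T? (ok (i + j) (i' + j) (at x i) (at x i'))) m

  mirrorCount : ℕ → ℕ → ℕ
  mirrorCount j m = count m (mirrored? j m)

  choices : ℕ → ℕ → ℕ
  choices a a' = (𝟙 (ok a a' true true) + 𝟙 (ok a a' true false))
               + (𝟙 (ok a a' false true) + 𝟙 (ok a a' false false))

  mirrored-peel : ∀ j m b c (w : Vec Bool m) →
    Mirrored j (2 + m) (b ∷ (w ∷ʳ c)) ⇔ (T (ok j (suc (m + j)) b c) × Mirrored (suc j) m w)
  mirrored-peel j m b c w = mk⇔ to from
    where
    outer : ok j (suc (m + j)) b (at (w ∷ʳ c) m) ≡ ok j (suc (m + j)) b c
    outer = cong (ok j (suc (m + j)) b) (at-∷ʳ w c)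
    inner : ∀ i i' → suc (i + i') ≡ m →
      ok (suc i + j) (suc i' + j) (at (w ∷ʳ c) i) (at (w ∷ʳ c) i')
        ≡ ok (i + suc j) (i' + suc j) (at w i) (at w i')
    inner i i' e
      rewrite +-suc i j | +-suc i' j
            | at-∷ʳ-< w c (mirror-<ˡ {i} {i'} e) | at-∷ʳ-< w c (mirror-<ʳ {i} {i'} e) = refl
    to : Mirrored j (2 + m) (b ∷ (w ∷ʳ c)) → T (ok j (suc (m + j)) b c) × Mirrored (suc j) m w
    to h = subst T outer (h 0 (suc m) refl)
         , λ i i' e → subst T (inner i i' e)
                             (h (suc i) (suc i') (cong (suc ∘ suc) (trans (+-suc i i') e)))
    last : T (ok j (suc (m + j)) b c) → ∀ i' → i' ≡ suc m →
      T (ok j (i' + j) b (at (b ∷ (w ∷ʳ c)) i'))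
    last o .(suc m) refl = subst T (sym outer) o
    from : T (ok j (suc (m + j)) b c) × Mirrored (suc j) m w → Mirrored j (2 + m) (b ∷ (w ∷ʳ c))
    from (o , h) zero    i'       e = last o i' (suc-injective e)
    from (o , h) (suc i) zero     e = subst T (ok-sym _ _ _ _) -- the outer pair, read backwards
      (last o (suc i) (cong suc (trans (sym (+-identityʳ i)) (suc-injective (suc-injective e)))))
    from (o , h) (suc i) (suc i') e = subst T (sym (inner i i' e')) (h i i' e')
      where
      e' : suc (i + i') ≡ m
      e' = trans (sym (+-suc i i')) (suc-injective (suc-injective e))

  mirrorCount-0 : ∀ j → mirrorCount j 0 ≡ 1
  mirrorCount-0 j = cong 𝟙 (dec-true (mirrored? j 0 []) λ _ _ ())

  mirrorCount-1 : ∀ j → mirrorCount j 1 ≡ 𝟙 (ok j j true true) + 𝟙 (ok j j false false)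
  mirrorCount-1 j = cong₂ _+_ (single true) (single false)
    where
    single : ∀ b → 𝟙 (does (mirrored? j 1 (b ∷ []))) ≡ 𝟙 (ok j j b b)
    single b = cong 𝟙 (does-⇔ (mk⇔ (λ h → h 0 0 refl) λ { t zero zero refl → t })
                              (mirrored? j 1 (b ∷ [])) (T? (ok j j b b)))

  mirrorCount-peel : ∀ j m → mirrorCount j (2 + m) ≡ choices j (suc (m + j)) * mirrorCount (suc j) m
  mirrorCount-peel j m = begin
    mirrorCount j (2 + m)
      ≡⟨ cong₂ _+_ (∑-∷ʳ m (f ∘ (true ∷_))) (∑-∷ʳ m (f ∘ (false ∷_))) ⟩
    (F true true + F true false) + (F false true + F false false)
      ≡⟨ cong₂ _+_ (cong₂ _+_ (corner true true) (corner true false))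
                   (cong₂ _+_ (corner false true) (corner false false)) ⟩
    (o true true * C + o true false * C) + (o false true * C + o false false * C)
      ≡⟨ distribʳ (o true true) (o true false) (o false true) (o false false) C ⟩
    choices j (suc (m + j)) * C
      ∎
    where
    open ≡-Reasoning
    f : Vec Bool (2 + m) → ℕ
    f x = 𝟙 (does (mirrored? j (2 + m) x))
    F : Bool → Bool → ℕ
    F b c = ∑ m (λ w → f (b ∷ (w ∷ʳ c)))
    o : Bool → Bool → ℕ
    o b c = 𝟙 (ok j (suc (m + j)) b c)
    C : ℕ
    C = mirrorCount (suc j) m
    corner : ∀ b c → F b c ≡ o b c * C
    corner b c = trans (∑-cong m term) (∑-*ˡ m (o b c) _)
      where
      term : ∀ w → f (b ∷ (w ∷ʳ c)) ≡ o b c * 𝟙 (does (mirrored? (suc j) m w))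
      term w = trans (cong 𝟙 (does-⇔ (mirrored-peel j m b c w) (mirrored? j (2 + m) (b ∷ (w ∷ʳ c)))
                                     (T? (ok j (suc (m + j)) b c) ×-dec mirrored? (suc j) m w)))
                     (𝟙-∧ (ok j (suc (m + j)) b c) _)
    distribʳ : ∀ a b c d x → (a * x + b * x) + (c * x + d * x) ≡ ((a + b) + (c + d)) * x
    distribʳ = solve-∀

Above : ℕ → ∀ {m} → Vec Bool m → Set
Above ℓ x = ∀ a → T (at x a) → ℓ ≤ a

NoMirrorPair : ℕ → (ℕ → Bool) → Set
NoMirrorPair K A = AllMirrorPairs K (λ i i' → ¬ (T (A i) × T (A i')))

module MissingSum (ℓ : ℕ) (Lf : ℕ → Bool) (Lf<ℓ : ∀ a → T (Lf a) → a < ℓ) where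

  allowed : ℕ → Bool → Bool
  allowed a b = not b ∨ (ℓ ≤ᵇ a)

  -- Mirror positions a, a' carrying bits b, c of R: not both in L ∪ R, and R has nothing below ℓ.
  -- Being Boolean, ok lets `choices` compute once Lf and the comparisons with ℓ are rewritten.
  ok : ℕ → ℕ → Bool → Bool → Bool
  ok a a' b c = not ((Lf a ∨ b) ∧ (Lf a' ∨ c)) ∧ (allowed a b ∧ allowed a' c)

  ok-sym : ∀ a a' b c → ok a a' b c ≡ ok a' a c b
  ok-sym a a' b c = cong₂ _∧_ (cong not (∧-comm (Lf a ∨ b) _)) (∧-comm (allowed a b) _)

  open Mirror ok ok-sym public

  allowed⇔ : ∀ a b → T (allowed a b) ⇔ (T b → ℓ ≤ a)
  allowed⇔ a true  = mk⇔ (λ t _ → ≤ᵇ⇒≤ ℓ a t) (λ h → ≤⇒≤ᵇ (h _))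
  allowed⇔ a false = mk⇔ (λ _ ()) _

  ok⇔ : ∀ a a' b c →
    T (ok a a' b c) ⇔ (¬ (T (Lf a ∨ b) × T (Lf a' ∨ c)) × (T b → ℓ ≤ a) × (T c → ℓ ≤ a'))
  ok⇔ a a' b c =
    ⇔-trans T-∧ (T-not-∧ _ _ ×-⇔ ⇔-trans T-∧ (allowed⇔ a b ×-⇔ allowed⇔ a' c))

  mirrored⇔ : ∀ {K} (x : Vec Bool K) →
    Mirrored 0 K x ⇔ (Above ℓ x × NoMirrorPair K (λ a → Lf a ∨ at x a))
  mirrored⇔ {K} x = mk⇔ to from
    where
    unshift : ∀ i i' → ok (i + 0) (i' + 0) (at x i) (at x i') ≡ ok i i' (at x i) (at x i')
    unshift i i' = cong₂ (λ a a' → ok a a' (at x i) (at x i')) (+-identityʳ i) (+-identityʳ i')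
    to : Mirrored 0 K x → Above ℓ x × NoMirrorPair K (λ a → Lf a ∨ at x a)
    to h = above , λ i i' e → proj₁ (Equivalence.to (ok⇔ _ _ _ _) (pair i i' e))
      where
      pair : ∀ i i' → suc (i + i') ≡ K → T (ok i i' (at x i) (at x i'))
      pair i i' e = subst T (unshift i i') (h i i' e)
      above : Above ℓ x
      above a t = proj₁ (proj₂ (Equivalence.to (ok⇔ _ _ _ _) (pair a (K ∸ suc a) a+[K-1-a]≡K))) t
        where
        a+[K-1-a]≡K : suc (a + (K ∸ suc a)) ≡ K
        a+[K-1-a]≡K = m+[n∸m]≡n (at-< x t)
    from : Above ℓ x × NoMirrorPair K (λ a → Lf a ∨ at x a) → Mirrored 0 K x
    from (above , none) i i' e =
      subst T (sym (unshift i i')) (Equivalence.from (ok⇔ _ _ _ _) (none i i' e , above i , above i'))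

  Lf-false : ∀ {a} → ℓ ≤ a → Lf a ≡ false
  Lf-false {a} ℓ≤a with Lf a | Lf<ℓ a
  ... | false | _   = refl
  ... | true  | a<ℓ = ⊥-elim (<⇒≱ (a<ℓ _) ℓ≤a)

  choices-inner : ∀ {a a'} → ℓ ≤ a → ℓ ≤ a' → choices a a' ≡ 3
  choices-inner ℓ≤a ℓ≤a'
    rewrite Lf-false ℓ≤a | Lf-false ℓ≤a' | ≤ᵇ-true ℓ≤a | ≤ᵇ-true ℓ≤a' = refl

  choices-outer : ∀ {a a'} → a < ℓ → ℓ ≤ a' → choices a a' * 2 ^ 𝟙 (Lf a) ≡ 2
  choices-outer {a} a<ℓ ℓ≤a'
    rewrite Lf-false ℓ≤a' | ≤ᵇ-false a<ℓ | ≤ᵇ-true ℓ≤a' with Lf a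
  ... | true  = refl
  ... | false = refl

  mirrorCount-center : ∀ {p j} → p ≤ 1 → ℓ ≤ j → mirrorCount j p ≡ 1
  mirrorCount-center {j = j} z≤n       ℓ≤j = mirrorCount-0 j
  mirrorCount-center {j = j} (s≤s z≤n) ℓ≤j rewrite mirrorCount-1 j | Lf-false ℓ≤j = refl

  mirrorCount-inner : ∀ e {p j} → p ≤ 1 → ℓ ≤ j → mirrorCount j (e * 2 + p) ≡ 3 ^ e
  mirrorCount-inner zero    p≤1 ℓ≤j = mirrorCount-center p≤1 ℓ≤j
  mirrorCount-inner (suc e) {p} {j} p≤1 ℓ≤j = trans (mirrorCount-peel j (e * 2 + p))
    (cong₂ _*_ (choices-inner ℓ≤j (≤-trans ℓ≤j (≤-trans (m≤n+m j (e * 2 + p)) (n≤1+n _))))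
               (mirrorCount-inner e p≤1 (m≤n⇒m≤1+n ℓ≤j)))

  mirrorCount-outer : ∀ d {j M} → d + j ≡ ℓ →
    mirrorCount j (d * 2 + M) * 2 ^ trues Lf j d ≡ 2 ^ d * mirrorCount ℓ M
  mirrorCount-outer zero    {j} {M} refl = *-comm (mirrorCount j M) 1
  mirrorCount-outer (suc d) {j} {M} e = begin
    mirrorCount j (2 + (d * 2 + M)) * 2 ^ (𝟙 (Lf j) + trues Lf (suc j) d)
      ≡⟨ cong₂ _*_ (mirrorCount-peel j (d * 2 + M)) (^-distribˡ-+-* 2 (𝟙 (Lf j)) _) ⟩
    choices j a' * mirrorCount (suc j) (d * 2 + M) * (2 ^ 𝟙 (Lf j) * 2 ^ trues Lf (suc j) d)
      ≡⟨ [m*n]*[o*p]≡[m*o]*[n*p] (choices j a') _ _ _ ⟩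
    choices j a' * 2 ^ 𝟙 (Lf j) * (mirrorCount (suc j) (d * 2 + M) * 2 ^ trues Lf (suc j) d)
      ≡⟨ cong₂ _*_ (choices-outer j<ℓ ℓ≤a') (mirrorCount-outer d (trans (+-suc d j) e)) ⟩
    2 * (2 ^ d * mirrorCount ℓ M)
      ≡⟨ *-assoc 2 (2 ^ d) _ ⟨
    2 ^ suc d * mirrorCount ℓ M
      ∎
    where
    open ≡-Reasoning
    a' : ℕ
    a' = suc (d * 2 + M + j)
    j<ℓ : j < ℓ
    j<ℓ = subst (j <_) e (s≤s (m≤n+m j d))
    ℓ≤a' : ℓ ≤ a'
    ℓ≤a' = subst (_≤ a') e (s≤s (+-monoˡ-≤ j (≤-trans (m≤m*n d 2) (m≤m+n (d * 2) M))))

inWindow⇔ : ∀ {n} ℓ u (R : Subset n) →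
  InWindow ℓ u R ⇔ (∀ a → T (at R a) → ℓ ≤ a × a + u < n)
inWindow⇔ ℓ u R = mk⇔ to (λ W i i∈R → W (toℕ i) (Equivalence.to ∈⇔at i∈R))
  where
  to : InWindow ℓ u R → ∀ a → T (at R a) → ℓ ≤ a × a + u < _
  to W a t with at⇒∈ R t
  ... | i , refl , i∈R = W i i∈R

window-++ : ∀ {ℓ K s u} → ℓ ≤ K → (x : Vec Bool K) (y : Vec Bool s) (z : Vec Bool u) →
  InWindow ℓ u (x ++ y ++ z) ⇔ (Above ℓ x × z ≡ ∅)
window-++ {ℓ} {K} {s} {u} ℓ≤K x y z =
  ⇔-trans (inWindow⇔ ℓ u (x ++ y ++ z)) (mk⇔ (λ W → above W , Empty-unique (z-empty W)) from)
  where
  Bounds : Set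
  Bounds = ∀ a → T (at (x ++ y ++ z) a) → ℓ ≤ a × a + u < K + (s + u)
  above : Bounds → Above ℓ x
  above W a t = proj₁ (W a (subst T (sym (at-++ˡ x (y ++ z) (at-< x t))) t))
  z-empty : Bounds → Empty z
  z-empty W (i , i∈z) = <⇒≱ (proj₂ (W (K + (s + toℕ i)) t)) K+[s+u]≤K+[s+i]+u
    where
    t : T (at (x ++ y ++ z) (K + (s + toℕ i)))
    t = subst T (sym (trans (at-++ʳ x (y ++ z) _) (at-++ʳ y z _))) (Equivalence.to ∈⇔at i∈z)
    K+[s+u]≤K+[s+i]+u : K + (s + u) ≤ K + (s + toℕ i) + u
    K+[s+u]≤K+[s+i]+u = begin
      K + (s + u)           ≤⟨ +-monoʳ-≤ K (+-monoʳ-≤ s (m≤n+m u (toℕ i))) ⟩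
      K + (s + (toℕ i + u)) ≡⟨ cong (_+_ K) (+-assoc s (toℕ i) u) ⟨
      K + (s + toℕ i + u)   ≡⟨ +-assoc K (s + toℕ i) u ⟨
      K + (s + toℕ i) + u   ∎
      where open ≤-Reasoning
  from : Above ℓ x × z ≡ ∅ → Bounds
  from (above , refl) a t with at-++ x (y ++ z) a t
  ... | inj₁ (a<K , tx) = above a tx , ≤-trans (+-monoˡ-< u a<K) (+-monoʳ-≤ K (m≤n+m u s))
  ... | inj₂ (b , refl , tw) with at-++ y ∅ b tw
  ...   | inj₁ (b<s , _)      = ≤-trans ℓ≤K (m≤m+n K b)
                              , subst (_< K + (s + u)) (sym (+-assoc K b u)) (+-monoʳ-< K (+-monoˡ-< u b<s))
  ...   | inj₂ (c , refl , tz) = ⊥-elim (at-∅ u c tz)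

Above⇔∅ : ∀ {ℓ} (x : Vec Bool ℓ) → Above ℓ x ⇔ x ≡ ∅
Above⇔∅ {ℓ} x = mk⇔
  (λ above → Empty-unique λ (i , i∈x) →
     <⇒≱ (toℕ<n i) (above (toℕ i) (Equivalence.to ∈⇔at i∈x)))
  (λ { refl a t → ⊥-elim (at-∅ ℓ a t) })

length-windowSubsets : ∀ ℓ m u → length (windowSubsets (ℓ + (m + u)) ℓ u) ≡ 2 ^ m
length-windowSubsets ℓ m u = begin
  length (windowSubsets (ℓ + (m + u)) ℓ u)
    ≡⟨ length-filter-allSubsets (ℓ + (m + u)) (inWindow? ℓ u) ⟩
  count (ℓ + (m + u)) (inWindow? ℓ u)
    ≡⟨ count-++³ ℓ m u (inWindow? ℓ u) (_≟ᵛ ∅) (_≟ᵛ ∅)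
                 (λ x y z → ⇔-trans (window-++ ≤-refl x y z) (Above⇔∅ x ×-⇔ ⇔-refl)) ⟩
  count ℓ (_≟ᵛ ∅) * count u (_≟ᵛ ∅) * 2 ^ m
    ≡⟨ cong₂ (λ a b → a * b * 2 ^ m) (count-≡ ℓ ∅) (count-≡ u ∅) ⟩
  1 * 1 * 2 ^ m
    ≡⟨ *-identityˡ (2 ^ m) ⟩
  2 ^ m
    ∎
  where open ≡-Reasoning

sums-to⇔ : ∀ {k K} → k +ℤ + 1 ≡ + K → ∀ a → (+ a ≡ k) ⇔ (suc a ≡ K)
sums-to⇔ {k} {K} k+1≡K a = mk⇔
  (λ a≡k → trans (sym (+-comm a 1)) (ℤ.+-injective (trans (cong (_+ℤ + 1) a≡k) k+1≡K)))
  (λ 1+a≡K → ℤ-cancelʳ (+ 1) (+ a) k (trans (cong +_ (trans (+-comm a 1) 1+a≡K)) (sym k+1≡K)))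

module _ {K r} (L U : Subset (K + r)) (U≥K : ∀ i → i ∈ U → K ≤ toℕ i)
         (x : Vec Bool K) (w : Vec Bool r) where

  InA⇒at : ∀ {i} → toℕ i < K → InA L (x ++ w) U i → T (at L (toℕ i) ∨ at x (toℕ i))
  InA⇒at i<K (inj₁ i∈L)        = Equivalence.from T-∨ (inj₁ (Equivalence.to ∈⇔at i∈L))
  InA⇒at i<K (inj₂ (inj₁ i∈R)) =
    Equivalence.from T-∨ (inj₂ (subst T (at-++ˡ x w i<K) (Equivalence.to ∈⇔at i∈R)))
  InA⇒at {i} i<K (inj₂ (inj₂ i∈U)) = ⊥-elim (<⇒≱ i<K (U≥K i i∈U))

  at⇒InA : ∀ {a} → a < K → T (at L a ∨ at x a) →
    Σ (Fin (K + r)) λ i → toℕ i ≡ a × InA L (x ++ w) U i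
  at⇒InA a<K t with Equivalence.to T-∨ t
  ... | inj₁ tL with at⇒∈ L tL
  ...   | i , eq , i∈L = i , eq , inj₁ i∈L
  at⇒InA a<K t | inj₂ tx with at⇒∈ (x ++ w) (subst T (sym (at-++ˡ x w a<K)) tx)
  ...   | i , eq , i∈R = i , eq , inj₂ (inj₁ i∈R)

  ∉sumset⇔ : ∀ {k} → k +ℤ + 1 ≡ + K →
    (¬ InSumset L (x ++ w) U k) ⇔ NoMirrorPair K (λ a → at L a ∨ at x a)
  ∉sumset⇔ {k} k+1≡K = mk⇔ to from
    where
    to : ¬ InSumset L (x ++ w) U k → NoMirrorPair K (λ a → at L a ∨ at x a)
    to k∉ i i' e (t , t') with at⇒InA (mirror-<ˡ e) t | at⇒InA (mirror-<ʳ e) t'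
    ... | j , refl , j∈A | j' , refl , j'∈A =
      k∉ (j , j' , j∈A , j'∈A , Equivalence.from (sums-to⇔ k+1≡K _) e)
    from : NoMirrorPair K (λ a → at L a ∨ at x a) → ¬ InSumset L (x ++ w) U k
    from none (j , j' , j∈A , j'∈A , j+j'≡k) =
      none (toℕ j) (toℕ j') e (InA⇒at (mirror-<ˡ e) j∈A , InA⇒at (mirror-<ʳ e) j'∈A)
      where
      e : suc (toℕ j + toℕ j') ≡ K
      e = Equivalence.to (sums-to⇔ k+1≡K _) j+j'≡k

badCount-formula : ∀ {ℓ u s e p K} (L U : Subset (K + (s + u))) {k} →
  K ≡ 2 * (ℓ + e) + p → p ≤ 1 → k +ℤ + 1 ≡ + K →
  (∀ i → i ∈ L → toℕ i < ℓ) → (∀ i → i ∈ U → K + (s + u) ≤ toℕ i + u) →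
  badCount (K + (s + u)) ℓ u L U k * 2 ^ ∣ L ∣ ≡ 2 ^ ℓ * 3 ^ e * 2 ^ s
badCount-formula {ℓ} {u} {s} {e} {p} {K} L U {k} K≡ p≤1 k+1≡K L<ℓ U≥n = begin
  badCount (K + (s + u)) ℓ u L U k * 2 ^ ∣ L ∣
    ≡⟨ cong₂ _*_ bad (cong (2 ^_) (∣∣≡trues-below L (≤-trans ℓ≤K (m≤m+n K _)) Lf<ℓ)) ⟩
  mirrorCount 0 K * 2 ^ s * 2 ^ trues Lf 0 ℓ
    ≡⟨ xy∙z≈xz∙y (mirrorCount 0 K) (2 ^ s) _ ⟩
  mirrorCount 0 K * 2 ^ trues Lf 0 ℓ * 2 ^ s
    ≡⟨ cong (_* 2 ^ s) weighted ⟩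
  2 ^ ℓ * 3 ^ e * 2 ^ s
    ∎
  where
  open ≡-Reasoning
  Lf : ℕ → Bool
  Lf = at L
  Lf<ℓ : ∀ a → T (Lf a) → a < ℓ
  Lf<ℓ a t with at⇒∈ L t
  ... | i , refl , i∈L = L<ℓ i i∈L
  open MissingSum ℓ Lf Lf<ℓ
  K≡ℓ*2+M : K ≡ ℓ * 2 + (e * 2 + p)
  K≡ℓ*2+M = trans K≡ (shape ℓ e p)
    where
    shape : ∀ ℓ e p → 2 * (ℓ + e) + p ≡ ℓ * 2 + (e * 2 + p)
    shape = solve-∀
  ℓ≤K : ℓ ≤ K
  ℓ≤K = subst (ℓ ≤_) (sym K≡ℓ*2+M) (≤-trans (m≤m*n ℓ 2) (m≤m+n (ℓ * 2) _))
  U≥K : ∀ i → i ∈ U → K ≤ toℕ i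
  U≥K i i∈U = ≤-trans (m≤m+n K s)
    (+-cancelʳ-≤ u (K + s) (toℕ i) (subst (_≤ toℕ i + u) (sym (+-assoc K s u)) (U≥n i i∈U)))
  Bad? : Decidable (λ R → InWindow ℓ u R × ¬ InSumset L R U k)
  Bad? R = inWindow? ℓ u R ×-dec ¬? (inSumset? L R U k)
  characterization : ∀ x y z →
    (InWindow ℓ u (x ++ y ++ z) × ¬ InSumset L (x ++ y ++ z) U k) ⇔ (Mirrored 0 K x × z ≡ ∅)
  characterization x y z = mk⇔
    (λ (W , k∉) → let above , z≡∅ = to window W in from mirror (above , to sumset k∉) , z≡∅)
    (λ (M , z≡∅) → let above , none = to mirror M in from window (above , z≡∅) , from sumset none)
    where
    open Equivalence
    window : InWindow ℓ u (x ++ y ++ z) ⇔ (Above ℓ x × z ≡ ∅)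
    window = window-++ ℓ≤K x y z
    sumset : (¬ InSumset L (x ++ y ++ z) U k) ⇔ NoMirrorPair K (λ a → at L a ∨ at x a)
    sumset = ∉sumset⇔ L U U≥K x (y ++ z) k+1≡K
    mirror : Mirrored 0 K x ⇔ (Above ℓ x × NoMirrorPair K (λ a → Lf a ∨ at x a))
    mirror = mirrored⇔ x
  bad : badCount (K + (s + u)) ℓ u L U k ≡ mirrorCount 0 K * 2 ^ s
  bad = begin
    badCount (K + (s + u)) ℓ u L U k
      ≡⟨ cong length (filter-filter (inWindow? ℓ u) (λ R → ¬? (inSumset? L R U k)) (allSubsets _)) ⟩
    length (filter Bad? (allSubsets _))
      ≡⟨ length-filter-allSubsets _ Bad? ⟩
    count (K + (s + u)) Bad?
      ≡⟨ count-++³ K s u Bad? (mirrored? 0 K) (_≟ᵛ ∅) characterization ⟩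
    mirrorCount 0 K * count u (_≟ᵛ ∅) * 2 ^ s
      ≡⟨ cong (λ c → mirrorCount 0 K * c * 2 ^ s) (count-≡ u ∅) ⟩
    mirrorCount 0 K * 1 * 2 ^ s
      ≡⟨ cong (_* 2 ^ s) (*-identityʳ (mirrorCount 0 K)) ⟩
    mirrorCount 0 K * 2 ^ s
      ∎
  weighted : mirrorCount 0 K * 2 ^ trues Lf 0 ℓ ≡ 2 ^ ℓ * 3 ^ e
  weighted = begin
    mirrorCount 0 K * 2 ^ trues Lf 0 ℓ
      ≡⟨ cong (λ K → mirrorCount 0 K * 2 ^ trues Lf 0 ℓ) K≡ℓ*2+M ⟩
    mirrorCount 0 (ℓ * 2 + (e * 2 + p)) * 2 ^ trues Lf 0 ℓ
      ≡⟨ mirrorCount-outer ℓ (+-identityʳ ℓ) ⟩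
    2 ^ ℓ * mirrorCount ℓ (e * 2 + p)
      ≡⟨ cong (_*_ (2 ^ ℓ)) (mirrorCount-inner e p≤1 ≤-refl) ⟩
    2 ^ ℓ * 3 ^ e
      ∎

k+u+1≡K+u : ∀ {k K} u → k +ℤ + 1 ≡ + K → k +ℤ + u +ℤ + 1 ≡ + (K + u)
k+u+1≡K+u {k} {K} u k+1≡K = begin
  k +ℤ + u +ℤ + 1   ≡⟨ ℤ.+-assoc k (+ u) (+ 1) ⟩
  k +ℤ (+ u +ℤ + 1) ≡⟨ cong (k +ℤ_) (ℤ.+-comm (+ u) (+ 1)) ⟩
  k +ℤ (+ 1 +ℤ + u) ≡⟨ ℤ.+-assoc k (+ 1) (+ u) ⟨
  k +ℤ + 1 +ℤ + u   ≡⟨ cong (_+ℤ + u) k+1≡K ⟩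
  + (K + u)         ∎
  where open ≡-Reasoning

split-≤ : ∀ {K u n} → K + u ≤ n → ∃[ s ] K + (s + u) ≡ n
split-≤ {K} {u} K+u≤n with m≤n⇒∃[o]m+o≡n K+u≤n
... | s , K+u+s≡n = s , trans (cong (_+_ K) (+-comm s u)) (trans (sym (+-assoc K u s)) K+u+s≡n)

4^e≡2^[e*2] : ∀ e → 4 ^ e ≡ 2 ^ (e * 2)
4^e≡2^[e*2] zero    = refl
4^e≡2^[e*2] (suc e) = trans (cong (_*_ 4) (4^e≡2^[e*2] e)) (*-assoc 2 2 (2 ^ (e * 2)))

badCount-ratio : ∀ n ℓ u (L U : Subset n) →
  (∀ i → i ∈ L → toℕ i < ℓ) → (∀ i → i ∈ U → n ≤ toℕ i + u) →
  ∀ k → k +ℤ + u +ℤ + 1 ≤ℤ + n → ∀ {K} e p → k +ℤ + 1 ≡ + K → p ≤ 1 → K ≡ 2 * (ℓ + e) + p →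
  badCount n ℓ u L U k * (2 ^ (∣ L ∣ + p) * 4 ^ e) ≡ length (windowSubsets n ℓ u) * 3 ^ e
badCount-ratio n ℓ u L U L<ℓ U≥n k k+u+1≤n {K} e p k+1≡K p≤1 K≡
  with split-≤ {K} {u} (ℤ.drop‿+≤+ (subst (_≤ℤ + n) (k+u+1≡K+u {k} {K} u k+1≡K) k+u+1≤n))
... | s , refl = begin
  bad * (2 ^ (∣ L ∣ + p) * 4 ^ e)
    ≡⟨ cong (λ t → bad * (t * 4 ^ e)) (^-distribˡ-+-* 2 ∣ L ∣ p) ⟩
  bad * (2 ^ ∣ L ∣ * 2 ^ p * 4 ^ e)
    ≡⟨ cong (_*_ bad) (*-assoc (2 ^ ∣ L ∣) (2 ^ p) (4 ^ e)) ⟩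
  bad * (2 ^ ∣ L ∣ * (2 ^ p * 4 ^ e))
    ≡⟨ *-assoc bad (2 ^ ∣ L ∣) _ ⟨
  bad * 2 ^ ∣ L ∣ * (2 ^ p * 4 ^ e)
    ≡⟨ cong (_* (2 ^ p * 4 ^ e)) (badCount-formula {e = e} L U K≡ p≤1 k+1≡K L<ℓ U≥n) ⟩
  2 ^ ℓ * 3 ^ e * 2 ^ s * (2 ^ p * 4 ^ e)
    ≡⟨ regroup (2 ^ ℓ) (3 ^ e) (2 ^ s) (2 ^ p) (4 ^ e) ⟩
  2 ^ ℓ * (4 ^ e * 2 ^ p) * 2 ^ s * 3 ^ e
    ≡⟨ cong (_* 3 ^ e) windows ⟨
  length (windowSubsets (K + (s + u)) ℓ u) * 3 ^ e
    ∎
  where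
  open ≡-Reasoning
  bad : ℕ
  bad = badCount (K + (s + u)) ℓ u L U k
  M : ℕ
  M = e * 2 + p
  regroup : ∀ a b c d f → a * b * c * (d * f) ≡ a * (f * d) * c * b
  regroup = solve-∀
  shape : ∀ ℓ e p s u → 2 * (ℓ + e) + p + (s + u) ≡ ℓ + ((ℓ + (e * 2 + p) + s) + u)
  shape = solve-∀
  windows : length (windowSubsets (K + (s + u)) ℓ u) ≡ 2 ^ ℓ * (4 ^ e * 2 ^ p) * 2 ^ s
  windows = begin
    length (windowSubsets (K + (s + u)) ℓ u)
      ≡⟨ cong (λ n → length (windowSubsets n ℓ u)) (trans (cong (_+ (s + u)) K≡) (shape ℓ e p s u)) ⟩
    length (windowSubsets (ℓ + ((ℓ + M + s) + u)) ℓ u)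
      ≡⟨ length-windowSubsets ℓ (ℓ + M + s) u ⟩
    2 ^ (ℓ + M + s)
      ≡⟨ ^-distribˡ-+-* 2 (ℓ + M) s ⟩
    2 ^ (ℓ + M) * 2 ^ s
      ≡⟨ cong (_* 2 ^ s) (^-distribˡ-+-* 2 ℓ M) ⟩
    2 ^ ℓ * 2 ^ M * 2 ^ s
      ≡⟨ cong (λ t → 2 ^ ℓ * t * 2 ^ s) (^-distribˡ-+-* 2 (e * 2) p) ⟩
    2 ^ ℓ * (2 ^ (e * 2) * 2 ^ p) * 2 ^ s
      ≡⟨ cong (λ t → 2 ^ ℓ * (t * 2 ^ p) * 2 ^ s) (4^e≡2^[e*2] e) ⟨
    2 ^ ℓ * (4 ^ e * 2 ^ p) * 2 ^ s
      ∎

lemma5 : (n ℓ u : ℕ) → ℓ + u ≤ n →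
    (L U : Subset n) →
    (∀ i → i ∈ L → toℕ i < ℓ) →
    (∀ i → i ∈ U → n ≤ toℕ i + u) →
    (k : ℤ) → + (2 * ℓ) ≤ℤ k +ℤ + 1 → k +ℤ + u +ℤ + 1 ≤ℤ + n →
    ((e : ℕ) → k +ℤ + 1 ≡ + (2 * (ℓ + e)) →
      badCount n ℓ u L U k * (2 ^ ∣ L ∣ * 4 ^ e)
        ≡ length (windowSubsets n ℓ u) * 3 ^ e)
    ×
    ((e : ℕ) → k ≡ + (2 * (ℓ + e)) →
      badCount n ℓ u L U k * (2 ^ (∣ L ∣ + 1) * 4 ^ e)
        ≡ length (windowSubsets n ℓ u) * 3 ^ e)
lemma5 n ℓ u _ L U L<ℓ U≥n k _ k+u+1≤n =
    (λ e k+1≡2[ℓ+e] →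
       subst (λ q → badCount n ℓ u L U k * (2 ^ q * 4 ^ e) ≡ length (windowSubsets n ℓ u) * 3 ^ e)
             (+-identityʳ ∣ L ∣)
             (ratio e 0 k+1≡2[ℓ+e] z≤n (sym (+-identityʳ _))))
  , (λ e k≡2[ℓ+e] → ratio e 1 (cong (_+ℤ + 1) k≡2[ℓ+e]) (s≤s z≤n) refl)
  where
  ratio : ∀ {K} e p → k +ℤ + 1 ≡ + K → p ≤ 1 → K ≡ 2 * (ℓ + e) + p →
    badCount n ℓ u L U k * (2 ^ (∣ L ∣ + p) * 4 ^ e) ≡ length (windowSubsets n ℓ u) * 3 ^ e
  ratio = badCount-ratio n ℓ u L U L<ℓ U≥n k k+u+1≤n
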